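{- Let $\rho,\pi\in S_n$. If $LTR(\rho)\subseteq LTR(\pi)$, then $|q^{ -1}(\rho)|\le|q^{ -1}(\pi)|$.
   Context: $S_n$ is the set of permutations of $\{1,\dots,n\}$ in one-line notation $\pi=\pi_1\cdots\pi_n$. An entry $\pi_i$ is a left-to-right (LTR) maximum if $\pi_i>\pi_j$ for all $j<i$; $LTR(\pi)=\{i\le n:\pi_i\text{ is an LTR maximum of }\pi\}$ is the set of positions of LTR maxima. The map $q:S_n\to S_n$ (the algorithm Queuesort, sorting with a queue allowing bypass): let $m_1,\dots,m_r$ be the LTR maxima of $\pi$ from left to right; for $i=r,\dots,1$ in this order, repeatedly swap $m_i$ with the entry immediately to its right as long as such an entry exists and is smaller than $m_i$; the result is $q(\pi)$. $q^{ -1}(\pi)=\{\sigma\in S_n: q(\sigma)=\pi\}$. -}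

module Defs where

open import Data.Nat using (ℕ; zero; suc; _<_; _<ᵇ_; _≡ᵇ_)
open import Data.Bool using (if_then_else_)
open import Data.List using (List; []; _∷_; foldr; map; upTo)
open import Data.Vec using (Vec; toList; lookup)
open import Data.Fin as Fin using (Fin)
open import Data.Product using (Σ; _×_; proj₁)
open import Relation.Binary.PropositionalEquality using (_≡_)
open import Data.List.Relation.Binary.Permutation.Propositional using (_↭_)

-- S_n : a word σ of length n (one-line notation) is a permutation of {1,…,n}
IsPerm : (n : ℕ) → Vec ℕ n → Set
IsPerm n σ = toList σ ↭ map suc (upTo n)

IsLTR : {n : ℕ} → Vec ℕ n → Fin n → Set
IsLTR σ i = ∀ j → j Fin.< i → lookup σ j < lookup σ i

_LTR⊆_ : {n : ℕ} → Vec ℕ n → Vec ℕ n → Set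
ρ LTR⊆ π = ∀ i → IsLTR ρ i → IsLTR π i

-- values of the LTR maxima, left to right (entries are ≥ 1, so start with 0)
ltrVals′ : ℕ → List ℕ → List ℕ
ltrVals′ m [] = []
ltrVals′ m (x ∷ xs) = if m <ᵇ x then x ∷ ltrVals′ x xs else ltrVals′ m xs

ltrVals : List ℕ → List ℕ
ltrVals = ltrVals′ 0

push : ℕ → List ℕ → List ℕ
push v [] = v ∷ []
push v (y ∷ ys) = if y <ᵇ v then y ∷ push v ys else v ∷ y ∷ ys

bubble : ℕ → List ℕ → List ℕ
bubble v [] = []
bubble v (x ∷ xs) = if x ≡ᵇ v then push v xs else x ∷ bubble v xs

-- Queuesort: for i = r, …, 1 bubble m_i;  foldr gives bubble m₁ (… (bubble m_r σ))
q : List ℕ → List ℕ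
q σ = foldr bubble σ (ltrVals σ)

Preimage : (n : ℕ) → Vec ℕ n → Set
Preimage n ρ = Σ (Vec ℕ n) (λ σ → IsPerm n σ × q (toList σ) ≡ toList ρ)

-- |q⁻¹(ρ)| ≤ |q⁻¹(π)| : an injection q⁻¹(ρ) → q⁻¹(π), injective on the
-- underlying permutations (both sets are finite subsets of S_n)
CardLeq : (n : ℕ) → Vec ℕ n → Vec ℕ n → Set
CardLeq n ρ π = Σ (Preimage n ρ → Preimage n π)
  (λ f → ∀ x y → proj₁ (f x) ≡ proj₁ (f y) → proj₁ x ≡ proj₁ y)

-- Relabel a permutation σ ∈ q⁻¹(ρ) entrywise by ρₖ ↦ πₖ. Every comparison Queuesort makes
-- while turning σ into ρ is between an LTR maximum b of ρ and an entry a that ends up to the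
-- left of b, i.e. between ρᵢ and ρⱼ with i < j ∈ LTR(ρ) ⊆ LTR(π); as πᵢ < πⱼ too, the
-- relabelling preserves the outcome of every comparison, hence commutes with q and maps
-- q⁻¹(ρ) injectively into q⁻¹(π).
module Submission where

open import Defs
open import Data.Nat using (ℕ; _<_; _≤_; _≮_; _<ᵇ_; _≡ᵇ_; z<s; s<s)
open import Data.Nat.Properties
open import Data.Bool using (true; false; if_then_else_)
open import Data.List as L using (List; []; _∷_; foldr)
open import Data.List.Relation.Unary.All as All using (All; []; _∷_)
import Data.List.Relation.Unary.All.Properties as All
open import Data.List.Relation.Unary.AllPairs using (_∷_)
open import Data.List.Membership.Propositional using (_∈_)
open import Data.List.Relation.Unary.Unique.Propositional using (Unique)
import Data.List.Relation.Unary.Unique.Propositional.Properties as Unique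
open import Data.List.Relation.Binary.Permutation.Propositional as ↭ using (_↭_; ↭-sym; ↭⇒↭ₛ)
import Data.List.Relation.Binary.Permutation.Propositional.Properties as ↭
import Data.List.Relation.Binary.Permutation.Setoid.Properties as ↭ₛ
open import Data.Vec as V using (Vec; []; _∷_; toList; lookup)
open import Data.Vec.Properties using (toList-map)
open import Data.Vec.Membership.Propositional.Properties using (∈-lookup; ∈-toList⁺; ∈-toList⁻)
open import Data.Vec.Relation.Unary.Any using (index)
open import Data.Vec.Relation.Unary.Any.Properties using (lookup-index)
open import Data.Fin as Fin using (zero; suc)
open import Data.Product using (∃-syntax; _×_; _,_; proj₁)
open import Relation.Nullary using (yes; no; contradiction)
open import Relation.Nullary.Decidable using (dec-true; dec-false)
open import Relation.Nullary.Reflects using (ofʸ; ofⁿ)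
open import Function using (_∘_)
open import Relation.Binary.PropositionalEquality

<⇒<ᵇ≡true : ∀ {m n} → m < n → (m <ᵇ n) ≡ true
<⇒<ᵇ≡true {m} {n} = dec-true (m <? n)

≮⇒<ᵇ≡false : ∀ {m n} → m ≮ n → (m <ᵇ n) ≡ false
≮⇒<ᵇ≡false {m} {n} = dec-false (m <? n)

≡ᵇ-refl : ∀ m → (m ≡ᵇ m) ≡ true
≡ᵇ-refl m = dec-true (m ≟ m) refl

≢⇒≡ᵇ≡false : ∀ {m n} → m ≢ n → (m ≡ᵇ n) ≡ false
≢⇒≡ᵇ≡false {m} {n} = dec-false (m ≟ n)

-- Queuesort of a suffix xs whose prefix has maximum m; the maxima are handled right to left
-- by recursion rather than by iterating over ltrVals.
qFrom : ℕ → List ℕ → List ℕ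
qFrom m [] = []
qFrom m (x ∷ xs) = if m <ᵇ x then push x (qFrom x xs) else x ∷ qFrom m xs

qFrom-< : ∀ {m x} xs → m < x → qFrom m (x ∷ xs) ≡ push x (qFrom x xs)
qFrom-< xs m<x rewrite <⇒<ᵇ≡true m<x = refl

qFrom-≮ : ∀ {m x} xs → m ≮ x → qFrom m (x ∷ xs) ≡ x ∷ qFrom m xs
qFrom-≮ xs m≮x rewrite ≮⇒<ᵇ≡false m≮x = refl

push-< : ∀ {v y} ys → y < v → push v (y ∷ ys) ≡ y ∷ push v ys
push-< ys y<v rewrite <⇒<ᵇ≡true y<v = refl

push-≮ : ∀ {v y} ys → y ≮ v → push v (y ∷ ys) ≡ v ∷ y ∷ ys
push-≮ ys y≮v rewrite ≮⇒<ᵇ≡false y≮v = refl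

push-0 : ∀ ys → push 0 ys ≡ 0 ∷ ys
push-0 [] = refl
push-0 (y ∷ ys) = refl

bubble-self : ∀ v zs → bubble v (v ∷ zs) ≡ push v zs
bubble-self v zs rewrite ≡ᵇ-refl v = refl

bubble-skip : ∀ {x v} zs → x < v → bubble v (x ∷ zs) ≡ x ∷ bubble v zs
bubble-skip zs x<v rewrite ≢⇒≡ᵇ≡false (<⇒≢ x<v) = refl

bubbles-skip : ∀ {x} ys {vs} → All (x <_) vs →
               foldr bubble (x ∷ ys) vs ≡ x ∷ foldr bubble ys vs
bubbles-skip ys [] = refl
bubbles-skip ys {v ∷ vs} (x<v ∷ x<vs)
  rewrite bubbles-skip ys x<vs = bubble-skip (foldr bubble ys vs) x<v

ltrVals′-above : ∀ m xs → All (m <_) (ltrVals′ m xs)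
ltrVals′-above m [] = []
ltrVals′-above m (x ∷ xs) with m <ᵇ x | <ᵇ-reflects-< m x
... | true  | ofʸ m<x = m<x ∷ All.map (<-trans m<x) (ltrVals′-above x xs)
... | false | ofⁿ _   = ltrVals′-above m xs

-- Bubbling the later maxima never moves an earlier maximum x, as they all exceed x.
bubble-ltrVals′ : ∀ m xs → foldr bubble xs (ltrVals′ m xs) ≡ qFrom m xs
bubble-ltrVals′ m [] = refl
bubble-ltrVals′ m (x ∷ xs) with m <ᵇ x | <ᵇ-reflects-< m x
... | true | ofʸ m<x = begin
  bubble x (foldr bubble (x ∷ xs) (ltrVals′ x xs))
    ≡⟨ cong (bubble x) (bubbles-skip xs (ltrVals′-above x xs)) ⟩
  bubble x (x ∷ foldr bubble xs (ltrVals′ x xs))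
    ≡⟨ cong (λ zs → bubble x (x ∷ zs)) (bubble-ltrVals′ x xs) ⟩
  bubble x (x ∷ qFrom x xs)
    ≡⟨ bubble-self x (qFrom x xs) ⟩
  push x (qFrom x xs) ∎
  where open ≡-Reasoning
... | false | ofⁿ m≮x = begin
  foldr bubble (x ∷ xs) (ltrVals′ m xs)
    ≡⟨ bubbles-skip xs (All.map (≤-<-trans (≮⇒≥ m≮x)) (ltrVals′-above m xs)) ⟩
  x ∷ foldr bubble xs (ltrVals′ m xs)
    ≡⟨ cong (x ∷_) (bubble-ltrVals′ m xs) ⟩
  x ∷ qFrom m xs ∎
  where open ≡-Reasoning

q≡qFrom0 : ∀ σ → q σ ≡ qFrom 0 σ
q≡qFrom0 = bubble-ltrVals′ 0

data LTRMax (b : ℕ) : List ℕ → Set where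
  here  : ∀ {zs} → LTRMax b (b ∷ zs)
  there : ∀ {c zs} → c < b → LTRMax b zs → LTRMax b (c ∷ zs)

data PrecedesLTRMax (a b : ℕ) : List ℕ → Set where
  here  : ∀ {zs} → a < b → LTRMax b zs → PrecedesLTRMax a b (a ∷ zs)
  there : ∀ {c zs} → c < b → PrecedesLTRMax a b zs → PrecedesLTRMax a b (c ∷ zs)

LTRMax-push : ∀ {b m zs} → LTRMax b zs → LTRMax b (push m zs)
LTRMax-push {b} {m} here with b <ᵇ m | <ᵇ-reflects-< b m
... | true  | _ = here
... | false | ofⁿ b≮m with m ≟ b
...   | yes refl = here
...   | no m≢b = there (≤∧≢⇒< (≮⇒≥ b≮m) m≢b) here
LTRMax-push {b} {m} (there {c} c<b b-max) with c <ᵇ m | <ᵇ-reflects-< c m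
... | true  | _ = there c<b (LTRMax-push b-max)
... | false | ofⁿ c≮m = there (≤-<-trans (≮⇒≥ c≮m) c<b) (there c<b b-max)

PrecedesLTRMax-push : ∀ {a b m zs} → PrecedesLTRMax a b zs → PrecedesLTRMax a b (push m zs)
PrecedesLTRMax-push {a} {b} {m} (here a<b b-max) with a <ᵇ m | <ᵇ-reflects-< a m
... | true  | _ = here a<b (LTRMax-push b-max)
... | false | ofⁿ a≮m = there (≤-<-trans (≮⇒≥ a≮m) a<b) (here a<b b-max)
PrecedesLTRMax-push {a} {b} {m} (there {c} c<b a-before-b) with c <ᵇ m | <ᵇ-reflects-< c m
... | true  | _ = there c<b (PrecedesLTRMax-push a-before-b)
... | false | ofⁿ c≮m = there (≤-<-trans (≮⇒≥ c≮m) c<b) (there c<b a-before-b)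

LTRMax-push-self : ∀ v zs → LTRMax v (push v zs)
LTRMax-push-self v [] = here
LTRMax-push-self v (y ∷ zs) with y <ᵇ v | <ᵇ-reflects-< y v
... | true  | ofʸ y<v = there y<v (LTRMax-push-self v zs)
... | false | _       = here

push-PrecedesLTRMax : ∀ {m b zs} → m < b → LTRMax b zs → PrecedesLTRMax m b (push m zs)
push-PrecedesLTRMax {m} {b} m<b here with b <ᵇ m | <ᵇ-reflects-< b m
... | true  | ofʸ b<m = contradiction b<m (<⇒≯ m<b)
... | false | _       = here m<b here
push-PrecedesLTRMax {m} {b} m<b (there {c} c<b b-max) with c <ᵇ m | <ᵇ-reflects-< c m
... | true  | _ = there c<b (push-PrecedesLTRMax m<b b-max)
... | false | _ = here m<b (there c<b b-max)

module _ (φ : ℕ → ℕ) where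

  -- qFrom m only ever compares pairs whose larger entry is at least m.
  PreservesLTRPairs : ℕ → List ℕ → Set
  PreservesLTRPairs m zs = ∀ {a b} → m ≤ b → PrecedesLTRMax a b zs → φ a < φ b

  map-push : ∀ v ys → PreservesLTRPairs v (push v ys) →
             L.map φ (push v ys) ≡ push (φ v) (L.map φ ys)
  map-push v [] _ = refl
  map-push v (y ∷ ys) preserves with y <ᵇ v | <ᵇ-reflects-< y v
  ... | true | ofʸ y<v = begin
    φ y ∷ L.map φ (push v ys)          ≡⟨ cong (φ y ∷_) (map-push v ys preserves′) ⟩
    φ y ∷ push (φ v) (L.map φ ys)      ≡⟨ push-< (L.map φ ys) φy<φv ⟨
    push (φ v) (φ y ∷ L.map φ ys)      ∎
    where
    open ≡-Reasoning
    φy<φv : φ y < φ v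
    φy<φv = preserves ≤-refl (here y<v (LTRMax-push-self v ys))
    preserves′ : PreservesLTRPairs v (push v ys)
    preserves′ v≤b = preserves v≤b ∘ there (<-≤-trans y<v v≤b)
  ... | false | ofⁿ y≮v = sym (push-≮ (L.map φ ys) φy≮φv)
    where
    φy≮φv : φ y ≮ φ v
    φy≮φv with v ≟ y
    ... | yes refl = <-irrefl refl
    ... | no v≢y = <⇒≯ (preserves (≮⇒≥ y≮v) (here (≤∧≢⇒< (≮⇒≥ y≮v) v≢y) here))

  map-qFrom : ∀ m xs → All (m ≢_) xs → Unique xs → PreservesLTRPairs m (push m (qFrom m xs)) →
              L.map φ (qFrom m xs) ≡ qFrom (φ m) (L.map φ xs)
  map-qFrom m [] _ _ _ = refl
  map-qFrom m (x ∷ xs) (m≢x ∷ m∉xs) (x∉xs ∷ xs-unique) preserves with m <ᵇ x | <ᵇ-reflects-< m x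
  ... | true | ofʸ m<x = begin
    L.map φ (push x (qFrom x xs))
      ≡⟨ map-push x (qFrom x xs) preservesₓ ⟩
    push (φ x) (L.map φ (qFrom x xs))
      ≡⟨ cong (push (φ x)) (map-qFrom x xs x∉xs xs-unique preservesₓ) ⟩
    push (φ x) (qFrom (φ x) (L.map φ xs))
      ≡⟨ qFrom-< (L.map φ xs) φm<φx ⟨
    qFrom (φ m) (φ x ∷ L.map φ xs) ∎
    where
    open ≡-Reasoning
    preservesₓ : PreservesLTRPairs x (push x (qFrom x xs))
    preservesₓ x≤b = preserves (<⇒≤ (<-≤-trans m<x x≤b)) ∘ PrecedesLTRMax-push
    φm<φx : φ m < φ x
    φm<φx = preserves (<⇒≤ m<x) (push-PrecedesLTRMax m<x (LTRMax-push-self x (qFrom x xs)))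
  ... | false | ofⁿ m≮x = begin
    φ x ∷ L.map φ (qFrom m xs)      ≡⟨ cong (φ x ∷_) (map-qFrom m xs m∉xs xs-unique preservesₘ) ⟩
    φ x ∷ qFrom (φ m) (L.map φ xs)  ≡⟨ qFrom-≮ (L.map φ xs) (<⇒≯ φx<φm) ⟨
    qFrom (φ m) (φ x ∷ L.map φ xs)  ∎
    where
    open ≡-Reasoning
    x<m : x < m
    x<m = ≤∧≢⇒< (≮⇒≥ m≮x) (m≢x ∘ sym)
    preserves′ : PreservesLTRPairs m (x ∷ push m (qFrom m xs))
    preserves′ m≤b = preserves m≤b ∘ subst (PrecedesLTRMax _ _) (sym (push-< (qFrom m xs) x<m))
    φx<φm : φ x < φ m
    φx<φm = preserves′ ≤-refl (here x<m (LTRMax-push-self m (qFrom m xs)))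
    preservesₘ : PreservesLTRPairs m (push m (qFrom m xs))
    preservesₘ m≤b = preserves′ m≤b ∘ there (<-≤-trans x<m m≤b)

  -- 0 stands for the maximum of the empty prefix, as in ltrVals.
  map-q : φ 0 ≡ 0 → ∀ σ → All (0 <_) σ → Unique σ →
          (∀ {a b} → PrecedesLTRMax a b (0 ∷ q σ) → φ a < φ b) →
          L.map φ (q σ) ≡ q (L.map φ σ)
  map-q φ0≡0 σ σ-positive σ-unique preserves = begin
    L.map φ (q σ)            ≡⟨ cong (L.map φ) (q≡qFrom0 σ) ⟩
    L.map φ (qFrom 0 σ)      ≡⟨ map-qFrom 0 σ (All.map <⇒≢ σ-positive) σ-unique preserves₀ ⟩
    qFrom (φ 0) (L.map φ σ)  ≡⟨ cong (λ m → qFrom m (L.map φ σ)) φ0≡0 ⟩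
    qFrom 0 (L.map φ σ)      ≡⟨ q≡qFrom0 (L.map φ σ) ⟨
    q (L.map φ σ)            ∎
    where
    open ≡-Reasoning
    preserves₀ : PreservesLTRPairs 0 (push 0 (qFrom 0 σ))
    preserves₀ _ = preserves ∘ subst (PrecedesLTRMax _ _)
      (trans (push-0 (qFrom 0 σ)) (cong (0 ∷_) (sym (q≡qFrom0 σ))))

relabel : ∀ {n} → Vec ℕ n → Vec ℕ n → ℕ → ℕ
relabel [] [] x = x
relabel (r ∷ rs) (p ∷ ps) x with x ≟ r
... | yes _ = p
... | no _  = relabel rs ps x

relabel-lookup : ∀ {n} (rs ps : Vec ℕ n) → Unique (toList rs) → ∀ k →
                 relabel rs ps (lookup rs k) ≡ lookup ps k
relabel-lookup (r ∷ rs) (p ∷ ps) _ zero with r ≟ r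
... | yes _   = refl
... | no r≢r  = contradiction refl r≢r
relabel-lookup (r ∷ rs) (p ∷ ps) (r∉rs ∷ rs-unique) (suc k) with lookup rs k ≟ r
... | yes rₖ≡r = contradiction (sym rₖ≡r) (All.lookup r∉rs (∈-toList⁺ (∈-lookup k rs)))
... | no _     = relabel-lookup rs ps rs-unique k

relabel-fresh : ∀ {n x} (rs ps : Vec ℕ n) → All (_≢ x) (toList rs) → relabel rs ps x ≡ x
relabel-fresh [] [] [] = refl
relabel-fresh {x = x} (r ∷ rs) (p ∷ ps) (r≢x ∷ x∉rs) with x ≟ r
... | yes x≡r = contradiction (sym x≡r) r≢x
... | no _    = relabel-fresh rs ps x∉rs

map-cancelˡ : ∀ {A B : Set} {n} {f : A → B} {g : B → A} (xs : Vec A n) →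
              All (λ x → g (f x) ≡ x) (toList xs) → V.map g (V.map f xs) ≡ xs
map-cancelˡ [] [] = refl
map-cancelˡ (x ∷ xs) (gfx≡x ∷ gf≡id) = cong₂ _∷_ gfx≡x (map-cancelˡ xs gf≡id)

map-≡-lookup : ∀ {A B : Set} {n} {f : A → B} (xs : Vec A n) (ys : Vec B n) →
               (∀ k → f (lookup xs k) ≡ lookup ys k) → V.map f xs ≡ ys
map-≡-lookup [] [] _ = refl
map-≡-lookup (x ∷ xs) (y ∷ ys) f≡ = cong₂ _∷_ (f≡ zero) (map-≡-lookup xs ys (f≡ ∘ suc))

IsLTR-∷ : ∀ {n c} (v : Vec ℕ n) {j} → c < lookup v j → IsLTR v j → IsLTR (c ∷ v) (suc j)
IsLTR-∷ v c<vⱼ vⱼ-max zero _ = c<vⱼ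
IsLTR-∷ v c<vⱼ vⱼ-max (suc i) (s<s i<j) = vⱼ-max i i<j

LTRMax⇒IsLTR : ∀ {n b} (v : Vec ℕ n) → LTRMax b (toList v) → ∃[ j ] lookup v j ≡ b × IsLTR v j
LTRMax⇒IsLTR (b ∷ v) here = zero , refl , λ _ ()
LTRMax⇒IsLTR (c ∷ v) (there c<b b-max) with LTRMax⇒IsLTR v b-max
... | j , refl , vⱼ-max = suc j , refl , IsLTR-∷ v c<b vⱼ-max

PrecedesLTRMax⇒IsLTR : ∀ {n a b} (v : Vec ℕ n) → PrecedesLTRMax a b (toList v) →
  ∃[ i ] ∃[ j ] i Fin.< j × lookup v i ≡ a × lookup v j ≡ b × IsLTR v j
PrecedesLTRMax⇒IsLTR (a ∷ v) (here a<b b-max) with LTRMax⇒IsLTR v b-max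
... | j , refl , vⱼ-max = zero , suc j , z<s , refl , refl , IsLTR-∷ v a<b vⱼ-max
PrecedesLTRMax⇒IsLTR (c ∷ v) (there c<b a-before-b) with PrecedesLTRMax⇒IsLTR v a-before-b
... | i , j , i<j , refl , refl , vⱼ-max =
  suc i , suc j , s<s i<j , refl , refl , IsLTR-∷ v c<b vⱼ-max

IsPerm⇒Unique : ∀ {n} {σ : Vec ℕ n} → IsPerm n σ → Unique (toList σ)
IsPerm⇒Unique {n} σ-perm =
  ↭ₛ.Unique-resp-↭ (setoid ℕ) (↭⇒↭ₛ (↭-sym σ-perm)) (Unique.map⁺ suc-injective (Unique.upTo⁺ n))

IsPerm⇒positive : ∀ {n} {σ : Vec ℕ n} → IsPerm n σ → All (0 <_) (toList σ)
IsPerm⇒positive σ-perm = ↭.All-resp-↭ (↭-sym σ-perm) (All.map⁺ (All.tabulate (λ _ → z<s)))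

module Relabelling {n} {ρ π : Vec ℕ n} (ρ-perm : IsPerm n ρ) (π-perm : IsPerm n π) where

  φ : ℕ → ℕ
  φ = relabel ρ π

  ψ : ℕ → ℕ
  ψ = relabel π ρ

  φ-lookup : ∀ k → φ (lookup ρ k) ≡ lookup π k
  φ-lookup = relabel-lookup ρ π (IsPerm⇒Unique ρ-perm)

  φ-0 : φ 0 ≡ 0
  φ-0 = relabel-fresh ρ π (All.map >⇒≢ (IsPerm⇒positive ρ-perm))

  map-φ-ρ : L.map φ (toList ρ) ≡ toList π
  map-φ-ρ = trans (sym (toList-map φ ρ)) (cong toList (map-≡-lookup ρ π φ-lookup))

  φ-preserves : ρ LTR⊆ π → ∀ {a b} → PrecedesLTRMax a b (0 ∷ toList ρ) → φ a < φ b
  φ-preserves _ (here _ b-max) with LTRMax⇒IsLTR ρ b-max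
  ... | j , refl , _ rewrite φ-0 | φ-lookup j =
    All.lookup (IsPerm⇒positive π-perm) (∈-toList⁺ (∈-lookup j π))
  φ-preserves ρ⊆π (there _ a-before-b) with PrecedesLTRMax⇒IsLTR ρ a-before-b
  ... | i , j , i<j , refl , refl , ρⱼ-max rewrite φ-lookup i | φ-lookup j = ρ⊆π j ρⱼ-max i i<j

  map-φ-perm : ∀ {σ} → IsPerm n σ → IsPerm n (V.map φ σ)
  map-φ-perm {σ} σ-perm = subst (_↭ _) (sym (toList-map φ σ))
    (↭.trans (↭.map⁺ φ (↭.trans σ-perm (↭-sym ρ-perm))) (subst (_↭ _) (sym map-φ-ρ) π-perm))

  ψφ≡id : ∀ {x} → x ∈ toList ρ → ψ (φ x) ≡ x
  ψφ≡id x∈ρ with index (∈-toList⁻ x∈ρ) | lookup-index (∈-toList⁻ x∈ρ)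
  ... | k | refl rewrite φ-lookup k = relabel-lookup π ρ (IsPerm⇒Unique π-perm) k

  map-φ-injective : ∀ {σ₁ σ₂} → IsPerm n σ₁ → IsPerm n σ₂ →
                    V.map φ σ₁ ≡ V.map φ σ₂ → σ₁ ≡ σ₂
  map-φ-injective {σ₁} {σ₂} σ₁-perm σ₂-perm φσ₁≡φσ₂ = begin
    σ₁                    ≡⟨ map-cancelˡ σ₁ (ψφ≡id-on σ₁-perm) ⟨
    V.map ψ (V.map φ σ₁)  ≡⟨ cong (V.map ψ) φσ₁≡φσ₂ ⟩
    V.map ψ (V.map φ σ₂)  ≡⟨ map-cancelˡ σ₂ (ψφ≡id-on σ₂-perm) ⟩
    σ₂                    ∎
    where
    open ≡-Reasoning
    ψφ≡id-on : ∀ {σ} → IsPerm n σ → All (λ x → ψ (φ x) ≡ x) (toList σ)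
    ψφ≡id-on σ-perm = All.tabulate (ψφ≡id ∘ ↭.∈-resp-↭ (↭.trans σ-perm (↭-sym ρ-perm)))

theorem4p4 : (n : ℕ) (ρ π : Vec ℕ n) → IsPerm n ρ → IsPerm n π →
    ρ LTR⊆ π → CardLeq n ρ π
theorem4p4 n ρ π ρ-perm π-perm ρ⊆π = relabel-preimage , preimage-injective
  where
  open Relabelling ρ-perm π-perm
  open ≡-Reasoning

  relabel-preimage : Preimage n ρ → Preimage n π
  relabel-preimage (σ , σ-perm , qσ≡ρ) = V.map φ σ , map-φ-perm σ-perm , (begin
    q (toList (V.map φ σ))  ≡⟨ cong q (toList-map φ σ) ⟩
    q (L.map φ (toList σ))  ≡⟨ map-q φ φ-0 (toList σ) σ-positive σ-unique preserves ⟨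
    L.map φ (q (toList σ))  ≡⟨ cong (L.map φ) qσ≡ρ ⟩
    L.map φ (toList ρ)      ≡⟨ map-φ-ρ ⟩
    toList π                ∎)
    where
    σ-positive : All (0 <_) (toList σ)
    σ-positive = IsPerm⇒positive σ-perm
    σ-unique : Unique (toList σ)
    σ-unique = IsPerm⇒Unique σ-perm
    preserves : ∀ {a b} → PrecedesLTRMax a b (0 ∷ q (toList σ)) → φ a < φ b
    preserves = φ-preserves ρ⊆π ∘ subst (λ τ → PrecedesLTRMax _ _ (0 ∷ τ)) qσ≡ρ

  preimage-injective : ∀ x y → proj₁ (relabel-preimage x) ≡ proj₁ (relabel-preimage y) →
                       proj₁ x ≡ proj₁ y
  preimage-injective (_ , σ₁-perm , _) (_ , σ₂-perm , _) = map-φ-injective σ₁-perm σ₂-perm
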